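{- Let $m\ge 3$ be an odd integer and $n$ a positive integer. Then $\alpha(m,n)\ge\alpha(1,n)\,\alpha(m-1,n)$.
   Context: For positive integers $m,n$, let $A(m,n)$ be the set of all $m\times n$ matrices with every entry in $\{1,-1\}$ such that every row sum and every column sum has absolute value at most $1$, and let $\alpha(m,n)=|A(m,n)|$. -}

module Defs where

open import Data.Nat using (ℕ; zero; suc)
open import Data.Integer using (ℤ; +_; -[1+_]; _+_; ∣_∣)
open import Data.Nat using (_≤_; _≤?_)
open import Data.List using (List; []; _∷_; concatMap; map; filter; length)
open import Data.Vec using (Vec; []; _∷_; foldr; transpose)
open import Data.Vec.Relation.Unary.All using (All; all?)
open import Data.Product using (_×_)
open import Relation.Nullary.Decidable using (Dec; _×-dec_)
open import Relation.Unary using (Decidable)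

data Sign : Set where
  plus minus : Sign

val : Sign → ℤ
val plus  = + 1
val minus = -[1+ 0 ]

allSigns : List Sign
allSigns = plus ∷ minus ∷ []

Matrix : ℕ → ℕ → Set
Matrix m n = Vec (Vec Sign n) m

allVecs : {A : Set} → List A → (n : ℕ) → List (Vec A n)
allVecs xs zero    = [] ∷ []
allVecs xs (suc n) = concatMap (λ x → map (x ∷_) (allVecs xs n)) xs

-- Exhaustive list of all m × n sign matrices (each appears exactly once).
allMatrices : (m n : ℕ) → List (Matrix m n)
allMatrices m n = allVecs (allVecs allSigns n) m

vsum : {k : ℕ} → Vec Sign k → ℤ
vsum = foldr _ (λ s acc → val s + acc) (+ 0)

Balanced : {k : ℕ} → Vec Sign k → Set
Balanced v = ∣ vsum v ∣ ≤ 1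

balanced? : {k : ℕ} → Decidable (Balanced {k})
balanced? v = ∣ vsum v ∣ ≤? 1

InA : {m n : ℕ} → Matrix m n → Set
InA M = All Balanced M × All Balanced (transpose M)

inA? : {m n : ℕ} → Decidable (InA {m} {n})
inA? M = all? balanced? M ×-dec all? balanced? (transpose M)

α : ℕ → ℕ → ℕ
α m n = length (filter inA? (allMatrices m n))

module Submission where

-- Let k = m - 1, which is even.  A column of a k × n matrix
-- in A(k,n) has an even number of ±1 entries, so its sum is even; being
-- of absolute value at most 1 it is therefore 0.  Consequently, putting
-- ANY balanced row r on top of a matrix M ∈ A(k,n) gives a matrix in
-- A(m,n): every new column sum is ±1 + 0.  The map (r , M) ↦ r ∷ M is
-- injective, so α(m,n) ≥ (#balanced rows) · α(k,n) = α(1,n) · α(k,n).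
--
-- Since
-- allMatrices m n lists the matrices r ∷ M row by row, the counting step
-- is an induction over that enumeration rather than an explicit injection.

open import Defs
open import Data.Nat using (ℕ; _≤_; _*_; _∸_; _%_)
open import Relation.Binary.PropositionalEquality using (_≡_)

open import Data.Nat using (zero; suc; z≤n; s≤s) renaming (_+_ to _+ℕ_)
open import Data.Nat.Properties using (≤-trans; ≤-reflexive; +-mono-≤; m≤n+m; m≤n⇒m≤1+n)
open import Data.Integer using (ℤ; +_; -[1+_]; _+_; ∣_∣)
open import Data.Integer.Properties using (+-assoc; +-commutativeSemigroup)
open import Algebra.Properties.CommutativeSemigroup +-commutativeSemigroup using (interchange)
open import Data.List using (List; []; _∷_; concatMap; map; filter; length; _++_)
open import Data.List.Properties using (filter-++; length-++)
open import Data.Vec using (Vec; []; _∷_; transpose; replicate; _⊛_)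
open import Data.Vec.Relation.Unary.All as All using (All; []; _∷_)
open import Data.Product using (_,_; ∃)
open import Relation.Nullary using (yes; no; contradiction)
open import Relation.Unary using (Decidable; Pred)
open import Relation.Binary.PropositionalEquality using (refl; sym; trans; cong; cong₂; subst; module ≡-Reasoning)
open import Level using (0ℓ)

private
  variable
    A B C : Set
    P Q R : Pred A 0ℓ
    k n : ℕ

count-++ : (R? : Decidable R) (xs ys : List A) →
  length (filter R? (xs ++ ys)) ≡ length (filter R? xs) +ℕ length (filter R? ys)
count-++ R? xs ys = trans (cong length (filter-++ R? xs ys)) (length-++ (filter R? xs))

count-singletons : (R? : Decidable R) (f : A → B) (xs : List A) →
  length (filter R? (concatMap (λ x → f x ∷ []) xs)) ≡ length (filter (λ x → R? (f x)) xs)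
count-singletons R? f [] = refl
count-singletons R? f (x ∷ xs) with R? (f x)
... | yes _ = cong suc (count-singletons R? f xs)
... | no  _ = count-singletons R? f xs

count-map : (P? : Decidable P) (R? : Decidable R) (f : A → B) →
  (∀ {x} → P x → R (f x)) → (xs : List A) →
  length (filter P? xs) ≤ length (filter R? (map f xs))
count-map P? R? f good [] = z≤n
count-map P? R? f good (x ∷ xs) with ih ← count-map P? R? f good xs | P? x | R? (f x)
... | yes _ | yes _  = s≤s ih
... | yes p | no ¬r  = contradiction (good p) ¬r
... | no  _ | yes _  = m≤n⇒m≤1+n ih
... | no  _ | no  _  = ih

count-pairs : (P? : Decidable P) (Q? : Decidable Q) (R? : Decidable R)
  (f : A → B → C) → (∀ {a b} → P a → Q b → R (f a b)) → (as : List A) (bs : List B) →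
  length (filter P? as) * length (filter Q? bs)
    ≤ length (filter R? (concatMap (λ a → map (f a) bs) as))
count-pairs P? Q? R? f good [] bs = z≤n
count-pairs P? Q? R? f good (a ∷ as) bs
  with ih ← count-pairs P? Q? R? f good as bs
     | split ← count-++ R? (map (f a) bs) (concatMap (λ a → map (f a) bs) as)
     | P? a
... | yes p = ≤-trans (+-mono-≤ (count-map Q? R? (f a) (good p) bs) ih) (≤-reflexive (sym split))
... | no _  = ≤-trans ih (≤-trans (m≤n+m _ _) (≤-reflexive (sym split)))

-- Evenness of a natural number, inductively, to drive pairwise induction on vectors.
data Even : ℕ → Set where
  even-zero : Even 0
  even-ss   : Even k → Even (suc (suc k))

odd-pred-even : (m : ℕ) → m % 2 ≡ 1 → Even (m ∸ 1)
odd-pred-even (suc zero)          _   = even-zero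
odd-pred-even (suc (suc (suc m))) odd = even-ss (odd-pred-even (suc m) odd)

sign-pair-double : (a b : Sign) → ∃ λ w → val a + val b ≡ w + w
sign-pair-double plus  plus  = + 1 , refl
sign-pair-double minus minus = -[1+ 0 ] , refl
sign-pair-double plus  minus = + 0 , refl
sign-pair-double minus plus  = + 0 , refl

vsum-even : Even k → (c : Vec Sign k) → ∃ λ z → vsum c ≡ z + z
vsum-even even-zero   []          = + 0 , refl
vsum-even (even-ss e) (a ∷ b ∷ c) with sign-pair-double a b | vsum-even e c
... | w , ab≡ww | z , c≡zz = w + z , (begin
    val a + (val b + vsum c) ≡⟨ sym (+-assoc (val a) (val b) (vsum c)) ⟩
    (val a + val b) + vsum c ≡⟨ cong₂ _+_ ab≡ww c≡zz ⟩
    (w + w) + (z + z)        ≡⟨ interchange w w z z ⟩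
    (w + z) + (w + z)        ∎)
  where open ≡-Reasoning

small-double-zero : (z : ℤ) → ∣ z + z ∣ ≤ 1 → z + z ≡ + 0
small-double-zero (+ zero)          _           = refl
small-double-zero (+ suc zero)      (s≤s ())
small-double-zero (+ suc (suc _))   (s≤s ())
small-double-zero -[1+ _ ]          (s≤s ())

balanced-even-zero : Even k → (c : Vec Sign k) → Balanced c → vsum c ≡ + 0
balanced-even-zero e c bal with vsum-even e c
... | z , c≡zz = trans c≡zz (small-double-zero z (subst (λ t → ∣ t ∣ ≤ 1) c≡zz bal))

prepend-balanced : (s : Sign) (c : Vec Sign k) → vsum c ≡ + 0 → Balanced (s ∷ c)
prepend-balanced s c c≡0 = subst (λ t → ∣ val s + t ∣ ≤ 1) (sym c≡0) (sign-bound s)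
  where
  sign-bound : (s : Sign) → ∣ val s + + 0 ∣ ≤ 1
  sign-bound plus  = s≤s z≤n
  sign-bound minus = s≤s z≤n

-- Columnwise: if every column of M sums to 0, every column of r ∷ M
-- (i.e. every vector of transpose (r ∷ M)) is balanced.
prepend-columns : (r : Vec Sign n) (cols : Vec (Vec Sign k) n) →
  All (λ c → vsum c ≡ + 0) cols → All Balanced ((replicate n _∷_ ⊛ r) ⊛ cols)
prepend-columns []      []          []           = []
prepend-columns (s ∷ r) (c ∷ cols) (c≡0 ∷ rest) = prepend-balanced s c c≡0 ∷ prepend-columns r cols rest

stack : Even k → (r : Vec Sign n) → Balanced r → (M : Matrix k n) → InA M → InA (r ∷ M)
stack e r bal M (rows , cols) =
  (bal ∷ rows) , prepend-columns r (transpose M) (All.map (λ {c} → balanced-even-zero e c) cols)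

proposition1 : (m n : ℕ) → 3 ≤ m → m % 2 ≡ 1 → 1 ≤ n →
    α 1 n * α (m ∸ 1) n ≤ α m n
proposition1 (suc k) n _ odd _ = begin
  α 1 n * α k n
    ≡⟨ cong (_* α k n) (count-singletons inA? (_∷ []) rows) ⟩
  length (filter (λ r → inA? (r ∷ [])) rows) * α k n
    ≤⟨ count-pairs (λ r → inA? (r ∷ [])) inA? inA? _∷_
         (λ { ((bal ∷ []) , _) → stack (odd-pred-even (suc k) odd) _ bal _ })
         rows (allMatrices k n) ⟩
  α (suc k) n ∎
  where
  open Data.Nat.Properties.≤-Reasoning
  rows = allVecs allSigns n
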